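{- Let $C_0$ be a binary linear $[n_0,n_0-r_0,3]_2$ code of covering radius $2$ with parity check matrix $H_0=[h_1\cdots h_{n_0}]$, and let $\mathcal{P}_0$ be a $2$-partition of the columns of $H_0$ into $p$ subsets. Let $m\ge1$ satisfy $2^m\ge p$. Assign indicators $\beta_j\in\{*\}\cup(\mathbb{F}_{2^m}\setminus\{1\})$, $j=1,\dots,n_0$, such that $\beta_i\ne\beta_j$ whenever $h_i,h_j$ lie in distinct subsets of $\mathcal{P}_0$. Fix a nonzero $w\in\mathbb{F}_2^m$, let $W_m\setminus w$ denote $W_m$ with the column $w$ removed, and let $$D=D_6=\begin{bmatrix}0_{r_0}&0_{r_0}&0_{r_0}\\ W_m\setminus w& w& 0_m\\ 0_m& w& W_m\setminus w\end{bmatrix}.$$ Then the code $C$ with parity check matrix $H_C=[D\,A(h_1,\beta_1)\cdots A(h_{n_0},\beta_{n_0})]$ (with $R=2$) is a binary linear $[n,n-r,3]_2$ code of covering radius $2$ with $n=2^m(n_0+2)-3$ and $r=r_0+2m$.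
   Context: Binary linear $[n,n-r,d]_2$ code: length $n$, codimension $r$, minimum distance $d$; covering radius $R$ = smallest integer such that every vector of $\mathbb{F}_2^r$ is a sum of at most $R$ columns of a parity check matrix. A $2$-partition of the columns of a parity check matrix $H$ (with $r$ rows) of a covering radius $2$ code is a partition of its columns (indexed by position) into nonempty subsets such that every column of $\mathbb{F}_2^r$ (the zero column being regarded as the empty sum) is a sum of at most $2$ columns of $H$ belonging to distinct subsets. Identify $\mathbb{F}_{2^m}$ with $\mathbb{F}_2^m$ via a fixed basis (elements are written as binary columns of length $m$), and enumerate $\mathbb{F}_{2^m}=\{\xi_1,\dots,\xi_{2^m}\}$ with $\xi_1=0$. For $\beta\in\mathbb{F}_{2^m}$, $A(h_j,\beta)$ is the $(r_0+2m)\times 2^m$ matrix with $k$-th column $(h_j,\xi_k,\beta\xi_k)^T$; for $\beta=*$, $A(h_j,*)$ has $k$-th column $(h_j,0_m,\xi_k)^T$. $W_m$ is the $m\times(2^m-1)$ matrix whose columns are all nonzero vectors of $\mathbb{F}_2^m$; $0_v$ denotes a zero matrix with $v$ rows. -}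

module Defs where

open import Data.Bool using (Bool; true; false; _xor_; if_then_else_)
open import Data.Nat using (ℕ; zero; suc; _+_; _≤_; _<_)
open import Data.Fin using (Fin)
open import Data.Vec using (Vec; []; _∷_; replicate; zipWith; _++_; lookup; fromList)
open import Data.List as L using (List; length; concat; map; filter)
import Data.List.Base as LB
open import Data.Maybe using (Maybe; just; nothing)
open import Data.Product using (Σ; ∃; _×_; _,_)
open import Data.Sum using (_⊎_)
open import Function using (id; _∘_)
open import Relation.Nullary using (¬_; Dec)
open import Relation.Binary.PropositionalEquality using (_≡_; _≢_)
open import Algebra.Structures using (IsCommutativeRing)
import Data.Vec.Properties as VP
open import Relation.Nullary.Decidable using (¬?)

Bits : ℕ → Set
Bits k = Vec Bool k

0v : ∀ {k} → Bits k
0v = replicate _ false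

_⊕_ : ∀ {k} → Bits k → Bits k → Bits k
_⊕_ = zipWith _xor_

weight : ∀ {k} → Bits k → ℕ
weight [] = 0
weight (true ∷ x) = suc (weight x)
weight (false ∷ x) = weight x

-- Parity check matrices with r rows, given as the list of their columns
-- (so the code length is the length of the list).

Matrix : ℕ → Set
Matrix r = List (Bits r)

syndrome : ∀ {r} (H : Matrix r) → Bits (length H) → Bits r
syndrome L.[] [] = 0v
syndrome (h L.∷ H) (true ∷ x) = h ⊕ syndrome H x
syndrome (h L.∷ H) (false ∷ x) = syndrome H x

IsCodeword : ∀ {r} (H : Matrix r) → Bits (length H) → Set
IsCodeword H x = syndrome H x ≡ 0v

-- minimum distance (= minimum weight of a nonzero codeword, code is linear)
HasMinDistance : ∀ {r} → Matrix r → ℕ → Set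
HasMinDistance H d =
  (∃ λ x → IsCodeword H x × weight x ≡ d) ×
  (∀ x → IsCodeword H x → x ≢ 0v → d ≤ weight x)

SumOfAtMost : ∀ {r} → Matrix r → ℕ → Bits r → Set
SumOfAtMost H R v = ∃ λ x → weight x ≤ R × syndrome H x ≡ v

Covers : ∀ {r} → Matrix r → ℕ → Set
Covers {r} H R = (v : Bits r) → SumOfAtMost H R v

HasCoveringRadius : ∀ {r} → Matrix r → ℕ → Set
HasCoveringRadius H R = Covers H R × (∀ R' → R' < R → ¬ Covers H R')

-- H (with r rows, n columns) is a parity check matrix of a binary linear
-- [n, n-r, d]_2 code of covering radius R
IsCode : ∀ {r} → Matrix r → (n d R : ℕ) → Set
IsCode H n d R = length H ≡ n × HasMinDistance H d × HasCoveringRadius H R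

-- 2-partitions: columns indexed by position, partition given by a map
-- assigning each position to one of p classes; every class nonempty.

Is2Partition : ∀ {r} (H : Matrix r) (p : ℕ) → (Fin (length H) → Fin p) → Set
Is2Partition {r} H p part =
  (∀ (c : Fin p) → ∃ λ i → part i ≡ c) ×
  (∀ (v : Bits r) →
     v ≡ 0v ⊎
     (∃ λ i → L.lookup H i ≡ v) ⊎
     (∃ λ i → ∃ λ j → part i ≢ part j × L.lookup H i ⊕ L.lookup H j ≡ v))

-- F_{2^m} identified with F_2^m via a fixed basis: addition is ⊕, and the
-- field multiplication is a map _·_ on Bits m with unit `one` making
-- (Bits m, ⊕, ·, 0, one) a field (negation is the identity in char 2).

record IsFieldMul (m : ℕ) (_·_ : Bits m → Bits m → Bits m) (one : Bits m) : Set where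
  field
    isCommutativeRing : IsCommutativeRing _≡_ _⊕_ _·_ id 0v one
    one≢0 : one ≢ 0v
    inverse : ∀ x → x ≢ 0v → ∃ λ y → (x · y) ≡ one

-- Fixed enumeration ξ_1, ..., ξ_{2^m} of F_2^m with ξ_1 = 0.
allBits : (m : ℕ) → List (Bits m)
allBits zero = [] L.∷ L.[]
allBits (suc m) = map (false ∷_) (allBits m) L.++ map (true ∷_) (allBits m)

isZero? : ∀ {k} (x : Bits k) → Dec (x ≡ 0v)
isZero? x = VP.≡-dec Data.Bool._≟_ x 0v
  where import Data.Bool

W : (m : ℕ) → List (Bits m)
W m = filter (λ x → ¬? (isZero? x)) (allBits m)

W∖ : (m : ℕ) → Bits m → List (Bits m)
W∖ m w = filter (λ x → ¬? (VP.≡-dec Data.Bool._≟_ x w)) (W m)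
  where import Data.Bool

-- indicator values: nothing = *, just b = b ∈ F_{2^m}
Indicator : ℕ → Set
Indicator m = Maybe (Bits m)

col : ∀ {r0 m} → Bits r0 → Bits m → Bits m → Bits (r0 + m + m)
col h a b = (h ++ a) ++ b

A : ∀ {r0 m} (_·_ : Bits m → Bits m → Bits m) → Bits r0 → Indicator m → Matrix (r0 + m + m)
A {m = m} _·_ h (just β) = map (λ ξ → col h ξ (β · ξ)) (allBits m)
A {m = m} _·_ h nothing  = map (λ ξ → col h 0v ξ) (allBits m)

D6 : (r0 m : ℕ) → Bits m → Matrix (r0 + m + m)
D6 r0 m w =
  map (λ u → col 0v u 0v) (W∖ m w) L.++
  (col 0v w w L.∷ L.[]) L.++
  map (λ u → col 0v 0v u) (W∖ m w)

HC : ∀ {r0 m} (_·_ : Bits m → Bits m → Bits m) (H0 : Matrix r0) →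
     (Fin (length H0) → Indicator m) → Bits m → Matrix (r0 + m + m)
HC {r0} {m} _·_ H0 β w =
  D6 r0 m w L.++ concat (LB.tabulate (λ j → A _·_ (L.lookup H0 j) (β j)))

-- Minimum distance 3 over F₂ means the columns are nonzero and pairwise distinct. The
-- columns of D are (0, a, b) with (a, b) ≠ 0 and pairwise distinct, and the blocks A(h_j, β_j)
-- are separated by their distinct nonzero top parts h_j; the columns (h_j, 0, 0) reproduce a
-- weight-3 codeword of H0. For the covering radius write a target as (v, b, c): the 2-partition
-- gives v = 0, v = h_j, or v = h_i + h_j with β_i ≠ β_j. The first case is settled inside D, the
-- second by a column of A(h_j, β_j) corrected by one column of D, and the third by one column
-- from each of the two blocks; when neither indicator is *, the column of A(h_i, β_i) is indexed
-- by the solution ξ of β_i ξ + β_j (ξ + b) = c, which exists since β_i ≠ β_j. Covering radius 1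
-- for H_C would project to covering radius 1 for H0.
module Submission where

open import Defs
open import Data.Nat using (ℕ; _+_; _*_; _∸_; _^_; _≤_; _≥_)
open import Data.Fin using (Fin)
open import Data.List using (length)
open import Data.Maybe using (Maybe; just; nothing)
open import Data.Product using (_×_)
open import Relation.Binary.PropositionalEquality using (_≡_; _≢_)

open import Algebra.Structures using (IsCommutativeRing)
open import Data.Bool using (true; false; _xor_)
import Data.Bool as Bool
open import Data.Bool.Properties using (xor-assoc; xor-comm; xor-identityˡ; xor-same)
open import Data.Empty using (⊥; ⊥-elim)
open import Data.Fin using (zero; suc)
import Data.Fin.Properties as Fin
import Data.List as L
open import Data.List using (List; []; _∷_; map; concat; filter; tabulate; lookup)
open import Data.List.Properties
  using (filter-accept; filter-reject; filter-all; length-++; length-map; map-tabulate; tabulate-lookup)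
open import Data.List.Membership.Propositional using (_∈_; lose)
open import Data.List.Membership.Propositional.Properties
  using ( ∈-++⁺ˡ; ∈-++⁺ʳ; ∈-++⁻; ∈-map⁺; ∈-map⁻; ∈-filter⁺; ∈-filter⁻; ∈-lookup
        ; ∈-concat⁺′; ∈-concat⁻′; ∈-tabulate⁺; ∈-tabulate⁻)
open import Data.List.Relation.Binary.Sublist.Propositional using (_⊆_; []; _∷ʳ_; _∷_)
open import Data.List.Relation.Binary.Sublist.Propositional.Properties using (++⁺ˡ)
open import Data.List.Relation.Unary.All as All using (All; []; _∷_)
import Data.List.Relation.Unary.All.Properties as All
open import Data.List.Relation.Unary.AllPairs using ([]; _∷_)
import Data.List.Relation.Unary.AllPairs.Properties as AllPairs
import Data.List.Relation.Unary.Any as Any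
open import Data.List.Relation.Unary.Any using (here; there)
open import Data.List.Relation.Unary.Unique.Propositional using (Unique)
import Data.List.Relation.Unary.Unique.Propositional.Properties as Unique
open import Data.Nat using (suc; zero; _<_; z≤n; s≤s; _≤?_)
open import Data.Nat.Properties using (+-identityʳ; n≤0⇒n≡0; ≤-trans; ≰⇒>; ≤⇒≯)
open import Data.Nat.Tactic.RingSolver using (solve-∀)
open import Data.Product using (∃; ∃₂; _,_; proj₁; proj₂)
open import Data.Sum using (_⊎_; inj₁; inj₂)
open import Data.Vec using (Vec; _∷_; _++_; splitAt)
import Data.Vec.Properties as Vec
open import Function using (_∘_)
open import Relation.Binary.PropositionalEquality using (refl; sym; trans; cong; cong₂; subst; module ≡-Reasoning)
open import Relation.Nullary using (Dec; yes; no; ¬_)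
open import Relation.Nullary.Decidable using (¬?; _×-dec_)

_≟_ : ∀ {k} → (x y : Bits k) → Dec (x ≡ y)
_≟_ = Vec.≡-dec Bool._≟_

⊕-assoc : ∀ {k} (x y z : Bits k) → (x ⊕ y) ⊕ z ≡ x ⊕ (y ⊕ z)
⊕-assoc = Vec.zipWith-assoc xor-assoc

⊕-comm : ∀ {k} (x y : Bits k) → x ⊕ y ≡ y ⊕ x
⊕-comm = Vec.zipWith-comm xor-comm

⊕-identityˡ : ∀ {k} (x : Bits k) → 0v ⊕ x ≡ x
⊕-identityˡ = Vec.zipWith-identityˡ xor-identityˡ

⊕-identityʳ : ∀ {k} (x : Bits k) → x ⊕ 0v ≡ x
⊕-identityʳ x = trans (⊕-comm x 0v) (⊕-identityˡ x)

⊕-self : ∀ {k} (x : Bits k) → x ⊕ x ≡ 0v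
⊕-self Vec.[] = refl
⊕-self (a ∷ x) = cong₂ _∷_ (xor-same a) (⊕-self x)

⊕-cancelʳ : ∀ {k} (x y : Bits k) → (x ⊕ y) ⊕ y ≡ x
⊕-cancelʳ x y = begin
  (x ⊕ y) ⊕ y  ≡⟨ ⊕-assoc x y y ⟩
  x ⊕ (y ⊕ y)  ≡⟨ cong (x ⊕_) (⊕-self y) ⟩
  x ⊕ 0v       ≡⟨ ⊕-identityʳ x ⟩
  x            ∎
  where open ≡-Reasoning

⊕-cancelˡ : ∀ {k} (x y : Bits k) → x ⊕ (x ⊕ y) ≡ y
⊕-cancelˡ x y = trans (⊕-comm x (x ⊕ y)) (trans (cong (_⊕ x) (⊕-comm x y)) (⊕-cancelʳ y x))

⊕≡0v⇒≡ : ∀ {k} (x y : Bits k) → x ⊕ y ≡ 0v → x ≡ y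
⊕≡0v⇒≡ x y x⊕y≡0 = trans (sym (⊕-cancelʳ x y)) (trans (cong (_⊕ y) x⊕y≡0) (⊕-identityˡ y))

≢⇒⊕≢0v : ∀ {k} {u v : Bits k} → u ≢ v → u ⊕ v ≢ 0v
≢⇒⊕≢0v {u = u} {v} u≢v = u≢v ∘ ⊕≡0v⇒≡ u v

≢0v⇒⊕≢ : ∀ {k} {u v : Bits k} → v ≢ 0v → u ⊕ v ≢ u
≢0v⇒⊕≢ {u = u} {v} v≢0 e = v≢0 (trans (sym (⊕-cancelˡ u v)) (trans (cong (u ⊕_) e) (⊕-self u)))

0v-++ : ∀ k l → 0v {k + l} ≡ 0v {k} ++ 0v {l}
0v-++ zero l = refl
0v-++ (suc k) l = cong (false ∷_) (0v-++ k l)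

col-0v : ∀ {k l} → col {k} {l} 0v 0v 0v ≡ 0v
col-0v {k} {l} = sym (trans (0v-++ (k + l) l) (cong (_++ 0v) (0v-++ k l)))

col-⊕ : ∀ {k l} (h h′ : Bits k) (a a′ b b′ : Bits l) →
        col h a b ⊕ col h′ a′ b′ ≡ col (h ⊕ h′) (a ⊕ a′) (b ⊕ b′)
col-⊕ h h′ a a′ b b′ =
  trans (Vec.zipWith-++ _xor_ (h ++ a) b (h′ ++ a′) b′)
        (cong (_++ (b ⊕ b′)) (Vec.zipWith-++ _xor_ h a h′ a′))

col-injective : ∀ {k l} (h h′ : Bits k) (a a′ b b′ : Bits l) →
                col h a b ≡ col h′ a′ b′ → h ≡ h′ × a ≡ a′ × b ≡ b′
col-injective h h′ a a′ _ _ e =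
  let ha≡ , b≡ = Vec.++-injective (h ++ a) (h′ ++ a′) e
      h≡ , a≡ = Vec.++-injective h h′ ha≡
  in h≡ , a≡ , b≡

weight-0v : ∀ k → weight (0v {k}) ≡ 0
weight-0v zero = refl
weight-0v (suc k) = weight-0v k

weight≡0⇒≡0v : ∀ {k} (x : Bits k) → weight x ≡ 0 → x ≡ 0v
weight≡0⇒≡0v Vec.[] _ = refl
weight≡0⇒≡0v (false ∷ x) e = cong (false ∷_) (weight≡0⇒≡0v x e)

module _ {r : ℕ} where

  MinWeightAtLeast : Matrix r → ℕ → Set
  MinWeightAtLeast H d = ∀ x → IsCodeword H x → x ≢ 0v → d ≤ weight x

  Projective : Matrix r → Set
  Projective H = All (_≢ 0v) H × Unique H

  syndrome-0v : (H : Matrix r) → syndrome H 0v ≡ 0v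
  syndrome-0v [] = refl
  syndrome-0v (h ∷ H) = syndrome-0v H

  ∈⇒weight-1-syndrome : {H : Matrix r} {c : Bits r} → c ∈ H →
                         ∃ λ x → weight x ≡ 1 × syndrome H x ≡ c
  ∈⇒weight-1-syndrome {h ∷ H} (here refl) =
    true ∷ 0v , cong suc (weight-0v (length H)) , trans (cong (h ⊕_) (syndrome-0v H)) (⊕-identityʳ h)
  ∈⇒weight-1-syndrome (there c∈H) =
    let x , wx , sx = ∈⇒weight-1-syndrome c∈H in false ∷ x , wx , sx

  syndrome-weight≤1 : (H : Matrix r) (x : Bits (length H)) → weight x ≤ 1 →
                      syndrome H x ≡ 0v ⊎ syndrome H x ∈ H
  syndrome-weight≤1 [] Vec.[] _ = inj₁ refl
  syndrome-weight≤1 (h ∷ H) (true ∷ x) (s≤s wx≤0)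
    rewrite weight≡0⇒≡0v x (n≤0⇒n≡0 wx≤0) | syndrome-0v H = inj₂ (here (⊕-identityʳ h))
  syndrome-weight≤1 (h ∷ H) (false ∷ x) wx≤1 with syndrome-weight≤1 H x wx≤1
  ... | inj₁ s≡0 = inj₁ s≡0
  ... | inj₂ s∈H = inj₂ (there s∈H)

  0v-sumOfAtMost : (H : Matrix r) (R : ℕ) → SumOfAtMost H R 0v
  0v-sumOfAtMost H R = 0v , subst (_≤ R) (sym (weight-0v (length H))) z≤n , syndrome-0v H

  ∈⇒sumOfAtMost : ∀ {H : Matrix r} {c} R → c ∈ H → SumOfAtMost H (suc R) c
  ∈⇒sumOfAtMost R c∈H =
    let x , wx , sx = ∈⇒weight-1-syndrome c∈H in x , subst (_≤ suc R) (sym wx) (s≤s z≤n) , sx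

  ∈⇒⊕-sumOfAtMost : ∀ {H : Matrix r} {c d} R → c ∈ H → d ∈ H → SumOfAtMost H (2 + R) (c ⊕ d)
  ∈⇒⊕-sumOfAtMost {h ∷ H} R (here refl) (here refl) =
    subst (SumOfAtMost (h ∷ H) (2 + R)) (sym (⊕-self h)) (0v-sumOfAtMost (h ∷ H) (2 + R))
  ∈⇒⊕-sumOfAtMost {h ∷ H} R (here refl) (there d∈H) =
    let x , wx , sx = ∈⇒weight-1-syndrome d∈H
    in true ∷ x , subst (λ n → suc n ≤ 2 + R) (sym wx) (s≤s (s≤s z≤n)) , cong (h ⊕_) sx
  ∈⇒⊕-sumOfAtMost {h ∷ H} {c} R (there c∈H) (here refl) =
    let x , wx , sx = ∈⇒weight-1-syndrome c∈H
    in true ∷ x , subst (λ n → suc n ≤ 2 + R) (sym wx) (s≤s (s≤s z≤n)) ,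
       trans (cong (h ⊕_) sx) (⊕-comm h c)
  ∈⇒⊕-sumOfAtMost R (there c∈H) (there d∈H) =
    let x , wx , sx = ∈⇒⊕-sumOfAtMost R c∈H d∈H in false ∷ x , wx , sx

  covers-mono : ∀ {H : Matrix r} {R R′} → R ≤ R′ → Covers H R → Covers H R′
  covers-mono R≤R′ cov v = let x , wx , sx = cov v in x , ≤-trans wx R≤R′ , sx

  sumOfAtMost-1 : ∀ {H : Matrix r} {v} → SumOfAtMost H 1 v → v ≡ 0v ⊎ v ∈ H
  sumOfAtMost-1 {H} (x , wx , refl) = syndrome-weight≤1 H x wx

  minWeight≥3⇒projective : (H : Matrix r) → MinWeightAtLeast H 3 → Projective H
  minWeight≥3⇒projective [] _ = [] , []
  minWeight≥3⇒projective (h ∷ H) mw = h≢0 ∷ proj₁ tail , All.tabulate h≢column ∷ proj₂ tail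
    where
    tail : Projective H
    tail = minWeight≥3⇒projective H λ x cw x≢0 → mw (false ∷ x) cw (x≢0 ∘ Vec.∷-injectiveʳ)

    no-light-codeword : ∀ x → IsCodeword (h ∷ H) x → x ≢ 0v → weight x ≤ 2 → ⊥
    no-light-codeword x cw x≢0 wx≤2 = ≤⇒≯ wx≤2 (mw x cw x≢0)

    h≢0 : h ≢ 0v
    h≢0 h≡0 = no-light-codeword (true ∷ 0v) cw (λ ())
                                (s≤s (subst (_≤ 1) (sym (weight-0v (length H))) z≤n))
      where
      cw : IsCodeword (h ∷ H) (true ∷ 0v)
      cw = trans (cong (h ⊕_) (syndrome-0v H)) (trans (⊕-identityʳ h) h≡0)

    h≢column : ∀ {c} → c ∈ H → h ≢ c
    h≢column c∈H refl =
      let x , wx , sx = ∈⇒weight-1-syndrome c∈H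
      in no-light-codeword (true ∷ x) (trans (cong (h ⊕_) sx) (⊕-self h)) (λ ())
                           (s≤s (subst (_≤ 1) (sym wx) (s≤s z≤n)))

  projective⇒minWeight≥3 : (H : Matrix r) → Projective H → MinWeightAtLeast H 3
  projective⇒minWeight≥3 H proj x cw x≢0 with 3 ≤? weight x
  ... | yes 3≤wx = 3≤wx
  ... | no 3≰wx with ≰⇒> 3≰wx
  ... | s≤s wx≤2 = ⊥-elim (light-codeword H proj x x≢0 wx≤2 cw)
    where
    light-codeword : (H : Matrix r) → Projective H → ∀ x → x ≢ 0v → weight x ≤ 2 → ¬ IsCodeword H x
    light-codeword [] _ Vec.[] x≢0 _ _ = x≢0 refl
    light-codeword (h ∷ H) (h≢0 ∷ _ , h∉H ∷ _) (true ∷ x) _ (s≤s wx≤1) cw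
      with syndrome-weight≤1 H x wx≤1
    ... | inj₁ s≡0 = h≢0 (trans (sym (trans (cong (h ⊕_) s≡0) (⊕-identityʳ h))) cw)
    ... | inj₂ s∈H = All.lookup h∉H s∈H (⊕≡0v⇒≡ h _ cw)
    light-codeword (h ∷ H) (_ ∷ nz , _ ∷ u) (false ∷ x) x≢0 wx≤2 cw =
      light-codeword H (nz , u) x (x≢0 ∘ cong (false ∷_)) wx≤2 cw

  ⊆⇒syndrome : ∀ {xs ys : Matrix r} → xs ⊆ ys → (x′ : Bits (length xs)) →
               ∃ λ x → weight x ≡ weight x′ × syndrome ys x ≡ syndrome xs x′
  ⊆⇒syndrome [] Vec.[] = Vec.[] , refl , refl
  ⊆⇒syndrome (_ ∷ʳ τ) x′ = let x , wx , sx = ⊆⇒syndrome τ x′ in false ∷ x , wx , sx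
  ⊆⇒syndrome (refl ∷ τ) (true ∷ x′) =
    let x , wx , sx = ⊆⇒syndrome τ x′ in true ∷ x , cong suc wx , cong (_ ⊕_) sx
  ⊆⇒syndrome (refl ∷ τ) (false ∷ x′) = let x , wx , sx = ⊆⇒syndrome τ x′ in false ∷ x , wx , sx

  distinct-classes : ∀ {H : Matrix r} {p part} → Is2Partition H p part → ¬ Covers H 1 →
                     ∃₂ λ i j → part i ≢ part j
  distinct-classes {H} {part = part} (_ , sums) ¬cov
    with Fin.any? (λ i → Fin.any? (λ j → ¬? (part i Fin.≟ part j)))
  ... | yes (i , j , i≁j) = i , j , i≁j
  ... | no ¬distinct = ⊥-elim (¬cov cover)
    where
    cover : Covers H 1
    cover v with sums v
    ... | inj₁ refl = 0v-sumOfAtMost H 1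
    ... | inj₂ (inj₁ (i , refl)) = ∈⇒sumOfAtMost {H = H} 0 (∈-lookup i)
    ... | inj₂ (inj₂ (i , j , i≁j , _)) = ⊥-elim (¬distinct (i , j , i≁j))

syndrome-map : ∀ {r s} (f : Bits r → Bits s) → (∀ a b → f (a ⊕ b) ≡ f a ⊕ f b) → f 0v ≡ 0v →
               (H : Matrix r) (x : Bits (length H)) →
               ∃ λ x′ → weight x′ ≡ weight x × syndrome (map f H) x′ ≡ f (syndrome H x)
syndrome-map f f-⊕ f-0v [] Vec.[] = Vec.[] , refl , sym f-0v
syndrome-map f f-⊕ f-0v (h ∷ H) (true ∷ x) =
  let x′ , wx′ , sx′ = syndrome-map f f-⊕ f-0v H x
  in true ∷ x′ , cong suc wx′ , trans (cong (f h ⊕_) sx′) (sym (f-⊕ h _))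
syndrome-map f f-⊕ f-0v (h ∷ H) (false ∷ x) =
  let x′ , wx′ , sx′ = syndrome-map f f-⊕ f-0v H x in false ∷ x′ , wx′ , sx′

allBits-complete : ∀ m (x : Bits m) → x ∈ allBits m
allBits-complete zero Vec.[] = here refl
allBits-complete (suc m) (false ∷ x) = ∈-++⁺ˡ (∈-map⁺ (false ∷_) (allBits-complete m x))
allBits-complete (suc m) (true ∷ x) =
  ∈-++⁺ʳ (map (false ∷_) (allBits m)) (∈-map⁺ (true ∷_) (allBits-complete m x))

allBits-unique : ∀ m → Unique (allBits m)
allBits-unique zero = [] ∷ []
allBits-unique (suc m) =
  Unique.++⁺ (Unique.map⁺ Vec.∷-injectiveʳ (allBits-unique m))
             (Unique.map⁺ Vec.∷-injectiveʳ (allBits-unique m))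
             disjoint
  where
  disjoint : ∀ {v} → ¬ (v ∈ map (false ∷_) (allBits m) × v ∈ map (true ∷_) (allBits m))
  disjoint (p , q) with ∈-map⁻ (false ∷_) p | ∈-map⁻ (true ∷_) q
  ... | _ , _ , refl | _ , _ , ()

allBits-head : ∀ m → ∃ λ t → allBits m ≡ 0v ∷ t
allBits-head zero = [] , refl
allBits-head (suc m) with allBits-head m
... | t , e rewrite e = _ , refl

length-allBits : ∀ m → length (allBits m) ≡ 2 ^ m
length-allBits zero = refl
length-allBits (suc m) = begin
  length (map (false ∷_) (allBits m) L.++ map (true ∷_) (allBits m))
    ≡⟨ length-++ (map (false ∷_) (allBits m)) ⟩
  length (map (false ∷_) (allBits m)) + length (map (true ∷_) (allBits m))
    ≡⟨ cong₂ _+_ (length-map (false ∷_) (allBits m)) (length-map (true ∷_) (allBits m)) ⟩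
  length (allBits m) + length (allBits m)
    ≡⟨ cong (λ n → n + n) (length-allBits m) ⟩
  2 ^ m + 2 ^ m
    ≡⟨ cong (2 ^ m +_) (sym (+-identityʳ (2 ^ m))) ⟩
  2 ^ suc m ∎
  where open ≡-Reasoning

length-filter-≢ : ∀ {A : Set} {c : A} (_≟c : ∀ x → Dec (x ≡ c)) {xs : List A} →
                  Unique xs → c ∈ xs → suc (length (filter (λ x → ¬? (x ≟c)) xs)) ≡ length xs
length-filter-≢ _≟c {y ∷ ys} (y∉ys ∷ _) (here refl) = cong suc (begin
  length (filter (λ x → ¬? (x ≟c)) (y ∷ ys))
    ≡⟨ cong length (filter-reject (λ x → ¬? (x ≟c)) (λ y≢y → y≢y refl)) ⟩
  length (filter (λ x → ¬? (x ≟c)) ys)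
    ≡⟨ cong length (filter-all (λ x → ¬? (x ≟c)) (All.map (λ y≢x → y≢x ∘ sym) y∉ys)) ⟩
  length ys ∎)
  where open ≡-Reasoning
length-filter-≢ _≟c {y ∷ ys} (y∉ys ∷ u) (there c∈ys) =
  trans (cong (suc ∘ length) (filter-accept (λ x → ¬? (x ≟c)) (All.lookup y∉ys c∈ys)))
        (cong suc (length-filter-≢ _≟c u c∈ys))

module _ (m : ℕ) where

  ∈W∖⁻ : ∀ {w u} → u ∈ W∖ m w → u ≢ 0v × u ≢ w
  ∈W∖⁻ u∈W∖ =
    let u∈W , u≢w = ∈-filter⁻ (λ x → ¬? (x ≟ _)) {xs = W m} u∈W∖
    in proj₂ (∈-filter⁻ (λ x → ¬? (isZero? x)) {xs = allBits m} u∈W) , u≢w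

  ∈W⁺ : ∀ {u} → u ≢ 0v → u ∈ W m
  ∈W⁺ u≢0 = ∈-filter⁺ (λ x → ¬? (isZero? x)) (allBits-complete m _) u≢0

  ∈W∖⁺ : ∀ {w u} → u ≢ 0v → u ≢ w → u ∈ W∖ m w
  ∈W∖⁺ u≢0 u≢w = ∈-filter⁺ (λ x → ¬? (x ≟ _)) (∈W⁺ u≢0) u≢w

  W-unique : Unique (W m)
  W-unique = Unique.filter⁺ (λ x → ¬? (isZero? x)) (allBits-unique m)

  W∖-unique : ∀ w → Unique (W∖ m w)
  W∖-unique w = Unique.filter⁺ (λ x → ¬? (x ≟ w)) W-unique

  length-W∖ : ∀ {w} → w ≢ 0v → 2 + length (W∖ m w) ≡ 2 ^ m
  length-W∖ {w} w≢0 = begin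
    2 + length (W∖ m w)   ≡⟨ cong suc (length-filter-≢ (_≟ w) W-unique (∈W⁺ w≢0)) ⟩
    suc (length (W m))    ≡⟨ length-filter-≢ isZero? (allBits-unique m) (allBits-complete m 0v) ⟩
    length (allBits m)    ≡⟨ length-allBits m ⟩
    2 ^ m                 ∎
    where open ≡-Reasoning

module _ {X : Set} {n : ℕ} (g : Fin n → List X) where

  ∈-concat-tabulate⁺ : ∀ j {c} → c ∈ g j → c ∈ concat (tabulate g)
  ∈-concat-tabulate⁺ j c∈gj = ∈-concat⁺′ c∈gj (∈-tabulate⁺ j)

  ∈-concat-tabulate⁻ : ∀ {c} → c ∈ concat (tabulate g) → ∃ λ j → c ∈ g j
  ∈-concat-tabulate⁻ c∈ with ∈-concat⁻′ (tabulate g) c∈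
  ... | _ , c∈xs , xs∈ with ∈-tabulate⁻ xs∈
  ... | j , refl = j , c∈xs

  concat-tabulate-unique : (∀ j → Unique (g j)) → (∀ {i j c} → c ∈ g i → c ∈ g j → i ≡ j) →
                           Unique (concat (tabulate g))
  concat-tabulate-unique unique disjoint =
    Unique.concat⁺ (All.tabulate⁺ unique) (AllPairs.tabulate⁺ λ i≢j (p , q) → i≢j (disjoint p q))

length-concat-tabulate : ∀ {X : Set} {n} (g : Fin n → List X) N → (∀ j → length (g j) ≡ N) →
                         length (concat (tabulate g)) ≡ n * N
length-concat-tabulate {n = zero} g N _ = refl
length-concat-tabulate {n = suc n} g N len =
  trans (length-++ (g zero)) (cong₂ _+_ (len zero) (length-concat-tabulate (g ∘ suc) N (len ∘ suc)))

tabulate-⊆-concat-tabulate : ∀ {X : Set} {n} (f : Fin n → X) (g : Fin n → List X) →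
                             (∀ j → ∃ λ t → g j ≡ f j ∷ t) → tabulate f ⊆ concat (tabulate g)
tabulate-⊆-concat-tabulate {n = zero} f g _ = []
tabulate-⊆-concat-tabulate {n = suc n} f g heads with heads zero
... | t , e rewrite e = refl ∷ ++⁺ˡ t (tabulate-⊆-concat-tabulate (f ∘ suc) (g ∘ suc) (heads ∘ suc))

lookup-injective : ∀ {X : Set} {xs : List X} → Unique xs → ∀ i j → lookup xs i ≡ lookup xs j → i ≡ j
lookup-injective {xs = _ ∷ _} _ zero zero _ = refl
lookup-injective {xs = _ ∷ _} (x∉ ∷ _) zero (suc j) e = ⊥-elim (All.lookup x∉ (∈-lookup j) e)
lookup-injective {xs = _ ∷ _} (x∉ ∷ _) (suc i) zero e = ⊥-elim (All.lookup x∉ (∈-lookup i) (sym e))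
lookup-injective {xs = _ ∷ _} (_ ∷ u) (suc i) (suc j) e = cong suc (lookup-injective u i j e)

length-arithmetic : ∀ L n₀ → L + suc L + n₀ * (2 + L) ≡ (2 + L) * (n₀ + 2) ∸ 3
length-arithmetic L n₀ = sym (cong (_∸ 3) (expand L n₀))
  where
  expand : ∀ L n₀ → (2 + L) * (n₀ + 2) ≡ 3 + (L + suc L + n₀ * (2 + L))
  expand = solve-∀

module Construction {r0 m : ℕ} (_·_ : Bits m → Bits m → Bits m) (H0 : Matrix r0)
                    (β : Fin (length H0) → Indicator m) {w : Bits m} (w≢0 : w ≢ 0v) where

  ⟨_,_,_⟩ : Bits r0 → Bits m → Bits m → Bits (r0 + m + m)
  ⟨ h , a , b ⟩ = col h a b

  D₁ D₃ : Matrix (r0 + m + m)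
  D₁ = map (λ u → ⟨ 0v , u , 0v ⟩) (W∖ m w)
  D₃ = map (λ u → ⟨ 0v , 0v , u ⟩) (W∖ m w)

  D : Matrix (r0 + m + m)
  D = D6 r0 m w

  block : Fin (length H0) → Matrix (r0 + m + m)
  block j = A _·_ (lookup H0 j) (β j)

  H : Matrix (r0 + m + m)
  H = HC _·_ H0 β w

  d₁∈ : ∀ {u} → u ≢ 0v → u ≢ w → ⟨ 0v , u , 0v ⟩ ∈ H
  d₁∈ u≢0 u≢w = ∈-++⁺ˡ (∈-++⁺ˡ (∈-map⁺ (λ u → ⟨ 0v , u , 0v ⟩) (∈W∖⁺ m u≢0 u≢w)))

  d₂∈ : ⟨ 0v , w , w ⟩ ∈ H
  d₂∈ = ∈-++⁺ˡ (∈-++⁺ʳ D₁ (here refl))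

  d₃∈ : ∀ {u} → u ≢ 0v → u ≢ w → ⟨ 0v , 0v , u ⟩ ∈ H
  d₃∈ u≢0 u≢w =
    ∈-++⁺ˡ (∈-++⁺ʳ D₁ (there (∈-map⁺ (λ u → ⟨ 0v , 0v , u ⟩) (∈W∖⁺ m u≢0 u≢w))))

  A∈ : ∀ {j b} → β j ≡ just b → ∀ ξ → ⟨ lookup H0 j , ξ , b · ξ ⟩ ∈ H
  A∈ {j} {b} βj≡b ξ = ∈-++⁺ʳ D (∈-concat-tabulate⁺ block j
    (subst (λ βj → ⟨ lookup H0 j , ξ , b · ξ ⟩ ∈ A _·_ (lookup H0 j) βj) (sym βj≡b)
           (∈-map⁺ (λ ξ → ⟨ lookup H0 j , ξ , b · ξ ⟩) (allBits-complete m ξ))))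

  A*∈ : ∀ {j} → β j ≡ nothing → ∀ ξ → ⟨ lookup H0 j , 0v , ξ ⟩ ∈ H
  A*∈ {j} βj≡* ξ = ∈-++⁺ʳ D (∈-concat-tabulate⁺ block j
    (subst (λ βj → ⟨ lookup H0 j , 0v , ξ ⟩ ∈ A _·_ (lookup H0 j) βj) (sym βj≡*)
           (∈-map⁺ (λ ξ → ⟨ lookup H0 j , 0v , ξ ⟩) (allBits-complete m ξ))))

  ∈A⇒ : ∀ h βj {c} → c ∈ A _·_ h βj → ∃₂ λ a b → c ≡ ⟨ h , a , b ⟩
  ∈A⇒ h (just b) c∈ = let ξ , _ , c≡ = ∈-map⁻ (λ ξ → ⟨ h , ξ , b · ξ ⟩) c∈ in ξ , b · ξ , c≡
  ∈A⇒ h nothing c∈ = let ξ , _ , c≡ = ∈-map⁻ (λ ξ → ⟨ h , 0v , ξ ⟩) c∈ in 0v , ξ , c≡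

  ⟨0,0,0⟩≡0v : ⟨ 0v , 0v , 0v ⟩ ≡ 0v
  ⟨0,0,0⟩≡0v = col-0v {r0} {m}

  col≡0v⇒ : ∀ h a b → ⟨ h , a , b ⟩ ≡ 0v → h ≡ 0v × a ≡ 0v × b ≡ 0v
  col≡0v⇒ h a b e = col-injective h 0v a 0v b 0v (trans e (sym ⟨0,0,0⟩≡0v))

  ∈D⇒ : ∀ {c} → c ∈ D → c ≢ 0v × ∃₂ λ a b → c ≡ ⟨ 0v , a , b ⟩
  ∈D⇒ c∈ with ∈-++⁻ D₁ c∈
  ... | inj₁ c∈d₁ with ∈-map⁻ (λ u → ⟨ 0v , u , 0v ⟩) c∈d₁
  ...   | u , u∈ , refl = proj₁ (∈W∖⁻ m u∈) ∘ proj₁ ∘ proj₂ ∘ col≡0v⇒ 0v u 0v , u , 0v , refl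
  ∈D⇒ c∈ | inj₂ (here refl) = w≢0 ∘ proj₁ ∘ proj₂ ∘ col≡0v⇒ 0v w w , w , w , refl
  ∈D⇒ c∈ | inj₂ (there c∈d₃) with ∈-map⁻ (λ u → ⟨ 0v , 0v , u ⟩) c∈d₃
  ...   | u , u∈ , refl = proj₁ (∈W∖⁻ m u∈) ∘ proj₂ ∘ proj₂ ∘ col≡0v⇒ 0v 0v u , 0v , u , refl

  ∈H⇒ : ∀ {c} → c ∈ H → (c ≢ 0v × ∃₂ λ a b → c ≡ ⟨ 0v , a , b ⟩)
                        ⊎ (∃ λ j → ∃₂ λ a b → c ≡ ⟨ lookup H0 j , a , b ⟩)
  ∈H⇒ c∈ with ∈-++⁻ D c∈
  ... | inj₁ c∈D = inj₁ (∈D⇒ c∈D)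
  ... | inj₂ c∈blocks =
    let j , c∈block = ∈-concat-tabulate⁻ block c∈blocks in inj₂ (j , ∈A⇒ _ (β j) c∈block)

  D-unique : Unique D
  D-unique =
    Unique.++⁺ D₁-unique (Unique.++⁺ ([] ∷ []) D₃-unique d₂∉d₃) d₁∉d₂d₃
    where
    D₁-unique : Unique D₁
    D₁-unique = Unique.map⁺ (λ {u} {u′} → proj₁ ∘ proj₂ ∘ col-injective 0v 0v u u′ 0v 0v) (W∖-unique m w)
    D₃-unique : Unique D₃
    D₃-unique = Unique.map⁺ (λ {u} {u′} → proj₂ ∘ proj₂ ∘ col-injective 0v 0v 0v 0v u u′) (W∖-unique m w)
    d₂∉d₃ : ∀ {c} → ¬ (c ∈ ⟨ 0v , w , w ⟩ ∷ [] × c ∈ D₃)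
    d₂∉d₃ (here refl , c∈d₃) with ∈-map⁻ (λ u → ⟨ 0v , 0v , u ⟩) c∈d₃
    ... | u , _ , e = w≢0 (proj₁ (proj₂ (col-injective 0v 0v w 0v w u e)))
    d₁∉d₂d₃ : ∀ {c} → ¬ (c ∈ D₁ × c ∈ ⟨ 0v , w , w ⟩ ∷ D₃)
    d₁∉d₂d₃ (c∈d₁ , c∈d₂d₃) with ∈-map⁻ (λ u → ⟨ 0v , u , 0v ⟩) c∈d₁ | c∈d₂d₃
    ... | u , _ , refl | here e = w≢0 (sym (proj₂ (proj₂ (col-injective 0v 0v u w 0v w e))))
    ... | u , u∈ , refl | there c∈d₃ with ∈-map⁻ (λ u → ⟨ 0v , 0v , u ⟩) c∈d₃
    ...   | u′ , _ , e = proj₁ (∈W∖⁻ m u∈) (proj₁ (proj₂ (col-injective 0v 0v u 0v 0v u′ e)))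

  A-unique : ∀ (h : Bits r0) βj → Unique (A _·_ h βj)
  A-unique h (just b) =
    Unique.map⁺ (λ {ξ} {ξ′} → proj₁ ∘ proj₂ ∘ col-injective h h ξ ξ′ (b · ξ) (b · ξ′))
                (allBits-unique m)
  A-unique h nothing =
    Unique.map⁺ (λ {ξ} {ξ′} → proj₂ ∘ proj₂ ∘ col-injective h h 0v 0v ξ ξ′) (allBits-unique m)

  H-projective : Projective H0 → Projective H
  H-projective (H0≢0 , H0-unique) = All.tabulate nonzero , Unique.++⁺ D-unique blocks-unique D∉blocks
    where
    nonzero : ∀ {c} → c ∈ H → c ≢ 0v
    nonzero c∈ with ∈H⇒ c∈
    ... | inj₁ (c≢0 , _) = c≢0
    ... | inj₂ (j , a , b , refl) = All.lookup H0≢0 (∈-lookup j) ∘ proj₁ ∘ col≡0v⇒ _ a b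

    blocks-unique : Unique (concat (tabulate block))
    blocks-unique = concat-tabulate-unique block (λ j → A-unique _ (β j)) λ {i} {j} c∈i c∈j →
      let a , b , c≡i = ∈A⇒ _ (β i) c∈i
          a′ , b′ , c≡j = ∈A⇒ _ (β j) c∈j
      in lookup-injective H0-unique i j (proj₁ (col-injective _ _ a a′ b b′ (trans (sym c≡i) c≡j)))

    D∉blocks : ∀ {c} → ¬ (c ∈ D × c ∈ concat (tabulate block))
    D∉blocks (c∈D , c∈blocks) with ∈D⇒ c∈D | ∈-concat-tabulate⁻ block c∈blocks
    ... | _ , a , b , refl | j , c∈block with ∈A⇒ _ (β j) c∈block
    ...   | a′ , b′ , e = All.lookup H0≢0 (∈-lookup j) (sym (proj₁ (col-injective 0v _ a a′ b b′ e)))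

  length-H : length H ≡ 2 ^ m * (length H0 + 2) ∸ 3
  length-H = begin
    length (D L.++ concat (tabulate block))
      ≡⟨ length-++ D ⟩
    length D + length (concat (tabulate block))
      ≡⟨ cong₂ _+_ length-D (length-concat-tabulate block (2 ^ m) length-block) ⟩
    L + suc L + length H0 * 2 ^ m
      ≡⟨ subst (λ N → L + suc L + length H0 * N ≡ N * (length H0 + 2) ∸ 3)
               (length-W∖ m w≢0) (length-arithmetic L (length H0)) ⟩
    2 ^ m * (length H0 + 2) ∸ 3
      ∎
    where
    open ≡-Reasoning
    L : ℕ
    L = length (W∖ m w)

    length-D : length D ≡ L + suc L
    length-D = trans (length-++ D₁)
                     (cong₂ (λ x y → x + suc y) (length-map _ (W∖ m w)) (length-map _ (W∖ m w)))

    length-block : ∀ j → length (block j) ≡ 2 ^ m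
    length-block j with β j
    ... | just b = trans (length-map _ (allBits m)) (length-allBits m)
    ... | nothing = trans (length-map _ (allBits m)) (length-allBits m)

  lift : Bits r0 → Bits (r0 + m + m)
  lift h = ⟨ h , 0v , 0v ⟩

  -- ξ₁ = 0, so every block A(h_j, β_j) begins with the column (h_j, 0, 0).
  lift-H0-⊆ : (∀ b → b · 0v ≡ 0v) → map lift H0 ⊆ H
  lift-H0-⊆ b·0≡0 =
    subst (_⊆ H) (trans (sym (map-tabulate (lookup H0) lift)) (cong (map lift) (tabulate-lookup H0)))
          (++⁺ˡ D (tabulate-⊆-concat-tabulate (lift ∘ lookup H0) block first-column))
    where
    first-column : ∀ j → ∃ λ t → block j ≡ lift (lookup H0 j) ∷ t
    first-column j with β j | allBits-head m
    ... | just b  | t , e rewrite e | b·0≡0 b = _ , refl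
    ... | nothing | t , e rewrite e = _ , refl

  lift-codeword : (∀ b → b · 0v ≡ 0v) → ∀ x₀ → IsCodeword H0 x₀ →
                  ∃ λ x → IsCodeword H x × weight x ≡ weight x₀
  lift-codeword b·0≡0 x₀ cw₀ =
    let x₁ , w₁ , s₁ = syndrome-map lift lift-⊕ ⟨0,0,0⟩≡0v H0 x₀
        x , w , s = ⊆⇒syndrome (lift-H0-⊆ b·0≡0) x₁
    in x , trans s (trans s₁ (trans (cong lift cw₀) ⟨0,0,0⟩≡0v)) , trans w w₁
    where
    lift-⊕ : ∀ a b → lift (a ⊕ b) ≡ lift a ⊕ lift b
    lift-⊕ a b = sym (trans (col-⊕ a b 0v 0v 0v 0v) (cong₂ (col (a ⊕ b)) (⊕-self 0v) (⊕-self 0v)))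

  covers₁⇒H0-covers₁ : Covers H 1 → Covers H0 1
  covers₁⇒H0-covers₁ cov v₀ =
    let _ , v₀≡t , t≡0∨t∈H0 = top-part in subst (SumOfAtMost H0 1) (sym v₀≡t) (covered t≡0∨t∈H0)
    where
    top-part : ∃ λ t → v₀ ≡ t × (t ≡ 0v ⊎ t ∈ H0)
    top-part with sumOfAtMost-1 (cov (lift v₀))
    ... | inj₁ lift≡0 = 0v , proj₁ (col≡0v⇒ v₀ 0v 0v lift≡0) , inj₁ refl
    ... | inj₂ lift∈H with ∈H⇒ lift∈H
    ...   | inj₁ (_ , a , b , e) = 0v , proj₁ (col-injective v₀ 0v 0v a 0v b e) , inj₁ refl
    ...   | inj₂ (j , a , b , e) = lookup H0 j , proj₁ (col-injective v₀ _ 0v a 0v b e) , inj₂ (∈-lookup j)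

    covered : ∀ {t} → t ≡ 0v ⊎ t ∈ H0 → SumOfAtMost H0 1 t
    covered (inj₁ refl) = 0v-sumOfAtMost H0 1
    covered (inj₂ t∈H0) = ∈⇒sumOfAtMost 0 t∈H0

module FieldLemmas {m : ℕ} {_·_ : Bits m → Bits m → Bits m} {one : Bits m}
                   (isField : IsFieldMul m _·_ one) where

  open IsFieldMul isField
  open IsCommutativeRing isCommutativeRing using (*-assoc; *-identityˡ; *-identityʳ; distribˡ; distribʳ; zeroˡ)

  ·-cancelʳ : ∀ {x y z} → z ≢ 0v → x · z ≡ y · z → x ≡ y
  ·-cancelʳ {x} {y} {z} z≢0 xz≡yz = let ζ , zζ≡1 = inverse z z≢0 in ⊕≡0v⇒≡ x y (begin
    x ⊕ y                      ≡⟨ sym (*-identityʳ (x ⊕ y)) ⟩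
    (x ⊕ y) · one              ≡⟨ cong ((x ⊕ y) ·_) (sym zζ≡1) ⟩
    (x ⊕ y) · (z · ζ)          ≡⟨ sym (*-assoc (x ⊕ y) z ζ) ⟩
    ((x ⊕ y) · z) · ζ          ≡⟨ cong (_· ζ) (distribʳ z x y) ⟩
    ((x · z) ⊕ (y · z)) · ζ    ≡⟨ cong (λ t → ((x · z) ⊕ t) · ζ) (sym xz≡yz) ⟩
    ((x · z) ⊕ (x · z)) · ζ    ≡⟨ cong (_· ζ) (⊕-self (x · z)) ⟩
    0v · ζ                     ≡⟨ zeroˡ ζ ⟩
    0v                         ∎)
    where open ≡-Reasoning

  pair-equation : ∀ {t₁ t₂ δ} b c → (t₁ ⊕ t₂) · δ ≡ one →
                  let ξ = δ · (c ⊕ (t₂ · b)) in (t₁ · ξ) ⊕ (t₂ · (ξ ⊕ b)) ≡ c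
  pair-equation {t₁} {t₂} {δ} b c inverse-δ = begin
    (t₁ · ξ) ⊕ (t₂ · (ξ ⊕ b))
      ≡⟨ cong ((t₁ · ξ) ⊕_) (distribˡ t₂ ξ b) ⟩
    (t₁ · ξ) ⊕ ((t₂ · ξ) ⊕ (t₂ · b))
      ≡⟨ sym (⊕-assoc _ _ _) ⟩
    ((t₁ · ξ) ⊕ (t₂ · ξ)) ⊕ (t₂ · b)
      ≡⟨ cong (_⊕ (t₂ · b)) (sym (distribʳ ξ t₁ t₂)) ⟩
    ((t₁ ⊕ t₂) · ξ) ⊕ (t₂ · b)
      ≡⟨ cong (_⊕ (t₂ · b)) (sym (*-assoc (t₁ ⊕ t₂) δ _)) ⟩
    (((t₁ ⊕ t₂) · δ) · (c ⊕ (t₂ · b))) ⊕ (t₂ · b)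
      ≡⟨ cong (λ t → (t · (c ⊕ (t₂ · b))) ⊕ (t₂ · b)) inverse-δ ⟩
    (one · (c ⊕ (t₂ · b))) ⊕ (t₂ · b)
      ≡⟨ cong (_⊕ (t₂ · b)) (*-identityˡ _) ⟩
    (c ⊕ (t₂ · b)) ⊕ (t₂ · b)
      ≡⟨ ⊕-cancelʳ c _ ⟩
    c ∎
    where
    open ≡-Reasoning
    ξ : Bits m
    ξ = δ · (c ⊕ (t₂ · b))

module Covering {r0 m : ℕ} {_·_ : Bits m → Bits m → Bits m} {one : Bits m}
                (isField : IsFieldMul m _·_ one) (H0 : Matrix r0) (β : Fin (length H0) → Indicator m)
                (β≢1 : ∀ j → β j ≢ just one)
                {w : Bits m} (w≢0 : w ≢ 0v) where

  open Construction _·_ H0 β w≢0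
  open FieldLemmas isField
  open IsFieldMul isField
  open IsCommutativeRing isCommutativeRing using (*-assoc; *-identityˡ; distribˡ; zeroˡ; zeroʳ)

  Covered : Bits (r0 + m + m) → Set
  Covered = SumOfAtMost H 2

  covered₁ : ∀ {c} → c ∈ H → Covered c
  covered₁ = ∈⇒sumOfAtMost 1

  covered₂ : ∀ {h h′ h″ a a′ a″ b b′ b″} → ⟨ h , a , b ⟩ ∈ H → ⟨ h′ , a′ , b′ ⟩ ∈ H →
             h ⊕ h′ ≡ h″ → a ⊕ a′ ≡ a″ → b ⊕ b′ ≡ b″ → Covered ⟨ h″ , a″ , b″ ⟩
  covered₂ {h} {h′} {_} {a} {a′} {_} {b} {b′} c∈ d∈ refl refl refl =
    subst Covered (col-⊕ h h′ a a′ b b′) (∈⇒⊕-sumOfAtMost 0 c∈ d∈)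

  data Kind (u : Bits m) : Set where
    is-0v   : u ≡ 0v → Kind u
    is-w    : u ≡ w → Kind u
    neither : u ≢ 0v → u ≢ w → Kind u

  kind : ∀ u → Kind u
  kind u with u ≟ 0v | u ≟ w
  ... | yes u≡0 | _ = is-0v u≡0
  ... | no _ | yes u≡w = is-w u≡w
  ... | no u≢0 | no u≢w = neither u≢0 u≢w

  -- When m = 1 the list W_m ∖ w is empty, and the two columns summing to (0, w, 0),
  -- resp. (0, 0, w), come from blocks with indicators 0 and *.
  Spare : Set
  Spare = (∃ λ u → u ≢ 0v × u ≢ w) ⊎ ((∃ λ j → β j ≡ just 0v) × (∃ λ j → β j ≡ nothing))

  spare : (∃₂ λ i j → β i ≢ β j) → Spare
  spare (i , j , βi≢βj) with Any.any? (λ u → ¬? (u ≟ 0v) ×-dec ¬? (u ≟ w)) (allBits m)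
  ... | yes found = inj₁ (Any.satisfied found)
  ... | no none = indicators (zero-or-* i) (zero-or-* j)
    where
    zero-or-w : ∀ u → u ≡ 0v ⊎ u ≡ w
    zero-or-w u with kind u
    ... | is-0v u≡0 = inj₁ u≡0
    ... | is-w u≡w = inj₂ u≡w
    ... | neither u≢0 u≢w = ⊥-elim (none (lose (allBits-complete m u) (u≢0 , u≢w)))

    zero-or-* : ∀ k → β k ≡ nothing ⊎ β k ≡ just 0v
    zero-or-* k with β k in βk≡
    ... | nothing = inj₁ refl
    ... | just t with zero-or-w t | zero-or-w one
    ...   | inj₁ refl | _ = inj₂ refl
    ...   | inj₂ _ | inj₁ one≡0 = ⊥-elim (one≢0 one≡0)
    ...   | inj₂ t≡w | inj₂ one≡w = ⊥-elim (β≢1 k (trans βk≡ (cong just (trans t≡w (sym one≡w)))))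

    indicators : (β i ≡ nothing ⊎ β i ≡ just 0v) → (β j ≡ nothing ⊎ β j ≡ just 0v) → Spare
    indicators (inj₁ βi≡*) (inj₁ βj≡*) = ⊥-elim (βi≢βj (trans βi≡* (sym βj≡*)))
    indicators (inj₁ βi≡*) (inj₂ βj≡0) = inj₂ ((j , βj≡0) , (i , βi≡*))
    indicators (inj₂ βi≡0) (inj₁ βj≡*) = inj₂ ((i , βi≡0) , (j , βj≡*))
    indicators (inj₂ βi≡0) (inj₂ βj≡0) = ⊥-elim (βi≢βj (trans βi≡0 (sym βj≡0)))

  cover-w-0 : Spare → Covered ⟨ 0v , w , 0v ⟩
  cover-w-0 (inj₁ (u , u≢0 , u≢w)) =
    covered₂ (d₁∈ (≢⇒⊕≢0v (u≢w ∘ sym)) (≢0v⇒⊕≢ u≢0)) (d₁∈ u≢0 u≢w)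
             (⊕-self 0v) (⊕-cancelʳ w u) (⊕-self 0v)
  cover-w-0 (inj₂ ((j , βj≡0) , _)) =
    covered₂ (A∈ βj≡0 0v) (A∈ βj≡0 w) (⊕-self _) (⊕-identityˡ w)
             (trans (cong₂ _⊕_ (zeroˡ 0v) (zeroˡ w)) (⊕-self 0v))

  cover-0-w : Spare → Covered ⟨ 0v , 0v , w ⟩
  cover-0-w (inj₁ (u , u≢0 , u≢w)) =
    covered₂ (d₃∈ (≢⇒⊕≢0v (u≢w ∘ sym)) (≢0v⇒⊕≢ u≢0)) (d₃∈ u≢0 u≢w)
             (⊕-self 0v) (⊕-self 0v) (⊕-cancelʳ w u)
  cover-0-w (inj₂ (_ , (j , βj≡*))) =
    covered₂ (A*∈ βj≡* 0v) (A*∈ βj≡* w) (⊕-self _) (⊕-self 0v) (⊕-identityˡ w)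

  cover-D : Spare → ∀ b c → Covered ⟨ 0v , b , c ⟩
  cover-D s b c with kind b | kind c
  ... | is-0v refl | is-0v refl = subst Covered (sym ⟨0,0,0⟩≡0v) (0v-sumOfAtMost H 2)
  ... | is-0v refl | is-w refl = cover-0-w s
  ... | is-0v refl | neither c≢0 c≢w = covered₁ (d₃∈ c≢0 c≢w)
  ... | is-w refl | is-0v refl = cover-w-0 s
  ... | is-w refl | is-w refl = covered₁ d₂∈
  ... | is-w refl | neither c≢0 c≢w =
    covered₂ d₂∈ (d₃∈ (≢⇒⊕≢0v (c≢w ∘ sym)) (≢0v⇒⊕≢ c≢0))
             (⊕-self 0v) (⊕-identityʳ w) (⊕-cancelˡ w c)
  ... | neither b≢0 b≢w | is-0v refl = covered₁ (d₁∈ b≢0 b≢w)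
  ... | neither b≢0 b≢w | is-w refl =
    covered₂ d₂∈ (d₁∈ (≢⇒⊕≢0v (b≢w ∘ sym)) (≢0v⇒⊕≢ b≢0))
             (⊕-self 0v) (⊕-cancelˡ w b) (⊕-identityʳ w)
  ... | neither b≢0 b≢w | neither c≢0 c≢w =
    covered₂ (d₁∈ b≢0 b≢w) (d₃∈ c≢0 c≢w) (⊕-self 0v) (⊕-identityʳ b) (⊕-identityˡ c)

  cover-A* : ∀ {j} → β j ≡ nothing → ∀ b c → Covered ⟨ lookup H0 j , b , c ⟩
  cover-A* βj≡* b c with kind b
  ... | is-0v refl = covered₁ (A*∈ βj≡* c)
  ... | is-w refl =
    covered₂ (A*∈ βj≡* (c ⊕ w)) d₂∈ (⊕-identityʳ _) (⊕-identityˡ w) (⊕-cancelʳ c w)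
  ... | neither b≢0 b≢w =
    covered₂ (A*∈ βj≡* c) (d₁∈ b≢0 b≢w) (⊕-identityʳ _) (⊕-identityˡ b) (⊕-identityʳ c)

  -- With γ = t⁻¹, the column (0, γ w, 0) of D lies outside {0, w} precisely because t ≠ 1.
  cover-A-w : ∀ {j t} → β j ≡ just t → t ≢ 0v → ∀ b c → (t · b) ⊕ c ≡ w →
              Covered ⟨ lookup H0 j , b , c ⟩
  cover-A-w {j} {t} βj≡t t≢0 b c e =
    covered₂ (A∈ βj≡t (b ⊕ u)) (d₁∈ u≢0 u≢w) (⊕-identityʳ _) (⊕-cancelʳ b u) bottom
    where
    γ u : Bits m
    γ = proj₁ (inverse t t≢0)
    u = γ · w

    tu≡w : t · u ≡ w
    tu≡w = trans (sym (*-assoc t γ w)) (trans (cong (_· w) (proj₂ (inverse t t≢0))) (*-identityˡ w))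

    u≢0 : u ≢ 0v
    u≢0 u≡0 = w≢0 (trans (sym tu≡w) (trans (cong (t ·_) u≡0) (zeroʳ t)))

    u≢w : u ≢ w
    u≢w u≡w = β≢1 j (trans βj≡t (cong just (·-cancelʳ w≢0 tw≡1w)))
      where
      tw≡1w : t · w ≡ one · w
      tw≡1w = trans (trans (cong (t ·_) (sym u≡w)) tu≡w) (sym (*-identityˡ w))

    bottom : (t · (b ⊕ u)) ⊕ 0v ≡ c
    bottom = begin
      (t · (b ⊕ u)) ⊕ 0v         ≡⟨ ⊕-identityʳ _ ⟩
      t · (b ⊕ u)                ≡⟨ distribˡ t b u ⟩
      (t · b) ⊕ (t · u)          ≡⟨ cong ((t · b) ⊕_) (trans tu≡w (sym e)) ⟩
      (t · b) ⊕ ((t · b) ⊕ c)    ≡⟨ ⊕-cancelˡ (t · b) c ⟩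
      c                          ∎
      where open ≡-Reasoning

  cover-A : ∀ {j t} → β j ≡ just t → ∀ b c → Covered ⟨ lookup H0 j , b , c ⟩
  cover-A {t = t} βj≡t b c with kind ((t · b) ⊕ c)
  ... | is-0v e = subst (λ c′ → Covered ⟨ _ , b , c′ ⟩) (⊕≡0v⇒≡ _ c e) (covered₁ (A∈ βj≡t b))
  ... | neither e≢0 e≢w =
    covered₂ (A∈ βj≡t b) (d₃∈ e≢0 e≢w) (⊕-identityʳ _) (⊕-identityʳ b) (⊕-cancelˡ (t · b) c)
  ... | is-w e with t ≟ 0v
  ...   | no t≢0 = cover-A-w βj≡t t≢0 b c e
  ...   | yes refl = covered₂ (A∈ βj≡t (b ⊕ w)) d₂∈ (⊕-identityʳ _) (⊕-cancelʳ b w) bottom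
    where
    c≡w : c ≡ w
    c≡w = trans (sym (⊕-identityˡ c)) (trans (cong (_⊕ c) (sym (zeroˡ b))) e)
    bottom : (0v · (b ⊕ w)) ⊕ w ≡ c
    bottom = trans (cong (_⊕ w) (zeroˡ (b ⊕ w))) (trans (⊕-identityˡ w) (sym c≡w))

  cover-pair : ∀ {i j} → β i ≢ β j → ∀ b c → Covered ⟨ lookup H0 i ⊕ lookup H0 j , b , c ⟩
  cover-pair {i} {j} βi≢βj b c with β i in βi≡ | β j in βj≡
  ... | nothing | nothing = ⊥-elim (βi≢βj refl)
  ... | nothing | just t =
    covered₂ (A*∈ βi≡ (c ⊕ (t · b))) (A∈ βj≡ b) refl (⊕-identityˡ b) (⊕-cancelʳ c _)
  ... | just t | nothing =
    covered₂ (A∈ βi≡ b) (A*∈ βj≡ ((t · b) ⊕ c)) refl (⊕-identityʳ b) (⊕-cancelˡ _ c)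
  ... | just t₁ | just t₂ =
    let δ , inverse-δ = inverse (t₁ ⊕ t₂) (βi≢βj ∘ cong just ∘ ⊕≡0v⇒≡ t₁ t₂)
        ξ = δ · (c ⊕ (t₂ · b))
    in covered₂ (A∈ βi≡ ξ) (A∈ βj≡ (ξ ⊕ b)) refl (⊕-cancelˡ ξ b) (pair-equation b c inverse-δ)

  cover-block : ∀ j b c → Covered ⟨ lookup H0 j , b , c ⟩
  cover-block j b c with β j in βj≡
  ... | nothing = cover-A* βj≡ b c
  ... | just _ = cover-A βj≡ b c

  H-covers : ∀ {p part} → Is2Partition H0 p part → (∀ i j → part i ≢ part j → β i ≢ β j) → Spare →
             Covers H 2
  H-covers (_ , sums) separated s v with splitAt (r0 + m) v
  ... | v′ , c , refl with splitAt r0 v′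
  ... | h , b , refl with sums h
  ... | inj₁ refl = cover-D s b c
  ... | inj₂ (inj₁ (j , refl)) = cover-block j b c
  ... | inj₂ (inj₂ (i , j , i≁j , refl)) = cover-pair (separated i j i≁j) b c

theorem5p1 : (r0 : ℕ) (H0 : Matrix r0) (n0 : ℕ) →
    IsCode H0 n0 3 2 →
    (p : ℕ) (part : Fin (length H0) → Fin p) → Is2Partition H0 p part →
    (m : ℕ) → m ≥ 1 → 2 ^ m ≥ p →
    (_·_ : Bits m → Bits m → Bits m) (one : Bits m) → IsFieldMul m _·_ one →
    (β : Fin (length H0) → Indicator m) →
    (∀ j → β j ≢ just one) →
    (∀ i j → part i ≢ part j → β i ≢ β j) →
    (w : Bits m) → w ≢ 0v →
    IsCode (HC _·_ H0 β w) (2 ^ m * (n0 + 2) ∸ 3) 3 2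
theorem5p1 _ H0 _ (refl , (codeword₀ , minWeight₀) , (_ , ¬covers₀)) _ _ partition
           _ _ _ _·_ _ isField β β≢1 separated _ w≢0 =
  length-H , (codeword , minWeight) , (H-covers partition separated spare-columns , ¬covers)
  where
  open Construction _·_ H0 β w≢0
  open Covering isField H0 β β≢1 w≢0
  open IsCommutativeRing (IsFieldMul.isCommutativeRing isField) using (zeroʳ)

  codeword : ∃ λ x → IsCodeword H x × weight x ≡ 3
  codeword = let x₀ , cw₀ , wx₀ = codeword₀
                 x , cw , wx = lift-codeword zeroʳ x₀ cw₀
             in x , cw , trans wx wx₀

  minWeight : MinWeightAtLeast H 3
  minWeight = projective⇒minWeight≥3 H (H-projective (minWeight≥3⇒projective H0 minWeight₀))

  ¬H0-covers₁ : ¬ Covers H0 1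
  ¬H0-covers₁ = ¬covers₀ 1 (s≤s (s≤s z≤n))

  spare-columns : Spare
  spare-columns =
    let i , j , i≁j = distinct-classes {H = H0} partition ¬H0-covers₁ in spare (i , j , separated i j i≁j)

  ¬covers : ∀ R → R < 2 → ¬ Covers H R
  ¬covers R (s≤s R≤1) = ¬H0-covers₁ ∘ covers₁⇒H0-covers₁ ∘ covers-mono {H = H} R≤1
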